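{- For every MTL formula $\varphi$ in negative normal form, the OCATA $\mathcal{A}_\varphi$ is a tree-like OCATA (TOCATA).
   Context: MTL: over a finite alphabet $\Sigma$, formulas are $\varphi::=\top\mid\sigma\mid\varphi_1\wedge\varphi_2\mid\neg\varphi\mid\varphi_1U_I\varphi_2$ with $\sigma\in\Sigma$ and $I$ an interval with endpoints in $\mathbb{N}\cup\{+\infty\}$. Abbreviations: $\bot=\neg\top$, $\varphi_1\vee\varphi_2=\neg(\neg\varphi_1\wedge\neg\varphi_2)$, $\varphi_1\tilde U_I\varphi_2=\neg(\neg\varphi_1U_I\neg\varphi_2)$. A formula is in negative normal form if it is built from $\top,\bot,\sigma,\neg\sigma$ ($\sigma\in\Sigma$) using $\wedge,\vee,U_I,\tilde U_I$. OCATA: for a finite set $L$, $\Gamma(L)$ is the set of formulas $\gamma::=\top\mid\bot\mid\gamma\vee\gamma\mid\gamma\wedge\gamma\mid\ell\mid x\bowtie c\mid x.\gamma$ ($\ell\in L$, $c\in\mathbb{N}$, ${\bowtie}\in\{<,\le,>,\ge\}$), identified modulo $x.(\gamma_1\vee\gamma_2)=x.\gamma_1\vee x.\gamma_2$, $x.(\gamma_1\wedge\gamma_2)=x.\gamma_1\wedge x.\gamma_2$, $x.x.\gamma=x.\gamma$, $x.\top=\top$, $x.\bot=\bot$, $x.(x\bowtie c)=$ truth value of $0\bowtie c$. An OCATA is $\mathcal{A}=(\Sigma,L,\ell_0,F,\delta)$ with $L$ a finite set of locations, $\ell_0\in L$, $F\subseteq L$, $\delta:L\times\Sigma\to\Gamma(L)$.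 A location $\ell'$ is present in $\delta(\ell,\sigma)$ if it occurs in it (possibly under $x.$). Construction of $\mathcal{A}_\varphi=(\Sigma,L,\ell_0,F,\delta)$ for $\varphi$ in negative normal form: $L$ consists of a fresh copy $\varphi_{init}$ of $\varphi$ together with all subformulas of $\varphi$ whose outermost connective is $U$ or $\tilde U$; $\ell_0=\varphi_{init}$; $F$ is the set of locations of the form $\varphi_1\tilde U_I\varphi_2$; and $\delta$ is defined inductively (extended to all subformulas): $\delta(\varphi_{init},\sigma)=x.\delta(\varphi,\sigma)$; $\delta(\varphi_1\vee\varphi_2,\sigma)=\delta(\varphi_1,\sigma)\vee\delta(\varphi_2,\sigma)$; $\delta(\varphi_1\wedge\varphi_2,\sigma)=\delta(\varphi_1,\sigma)\wedge\delta(\varphi_2,\sigma)$; $\delta(\varphi_1U_I\varphi_2,\sigma)=(x.\delta(\varphi_2,\sigma)\wedge x\in I)\vee(x.\delta(\varphi_1,\sigma)\wedge\varphi_1U_I\varphi_2\wedge x\le\sup I)$; $\delta(\varphi_1\tilde U_I\varphi_2,\sigma)=(x.\delta(\varphi_2,\sigma)\vee x\notin I)\wedge(x.\delta(\varphi_1,\sigma)\vee\varphi_1\tilde U_I\varphi_2\vee x>\sup I)$; $\delta(\sigma_1,\sigma_2)=\top$ if $\sigma_1=\sigma_2$ and $\bot$ otherwise; $\delta(\neg\sigma_1,\sigma_2)=\bot$ if $\sigma_1=\sigma_2$ and $\top$ otherwise; $\delta(\top,\sigma)=\top$, $\delta(\bot,\sigma)=\bot$. Here $x\in I$, $x\notin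 I$, $x\le\sup I$, $x>\sup I$ denote the corresponding Boolean combinations of clock constraints (with $x\le+\infty$ read as $\top$ and $x>+\infty$ as $\bot$); in the right-hand sides the occurrence of the formula $\varphi_1U_I\varphi_2$ (resp. $\varphi_1\tilde U_I\varphi_2$) itself denotes the location. TOCATA: an OCATA $\mathcal{A}=(\Sigma,L,\ell_0,F,\delta)$ is tree-like (a TOCATA) iff there is a partition $L_1,\dots,L_m$ of $L$ such that (1) for each $i$, either $L_i\subseteq F$ or $L_i\cap F=\emptyset$; and (2) there is a partial order $\preccurlyeq$ on $\{L_1,\dots,L_m\}$ such that whenever there are $\sigma\in\Sigma$, $\ell\in L_i$ and $\ell'\in L_j$ with $\ell'$ present in $\delta(\ell,\sigma)$, then $L_j\preccurlyeq L_i$. -}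

module Defs where

open import Data.Nat using (ℕ)
open import Data.Fin using (Fin; _≟_)
open import Data.Bool using (Bool; true; false)
open import Data.Maybe using (Maybe; just; nothing)
open import Data.Product using (Σ; ∃; _×_; _,_)
open import Data.Sum using (_⊎_)
open import Relation.Nullary using (¬_; yes; no)
open import Relation.Binary.PropositionalEquality using (_≡_)
open import Relation.Binary.Structures using (IsPartialOrder)

-- Intervals with endpoints in ℕ ∪ {+∞}.
-- lower endpoint a ∈ ℕ (closed or open), upper endpoint b ∈ ℕ or +∞
-- (nothing = +∞; closedness of +∞ is irrelevant).

record Interval : Set where
  constructor interval
  field
    lo       : ℕ
    loClosed : Bool
    hi       : Maybe ℕ
    hiClosed : Bool

data NNF (k : ℕ) : Set where
  tt ff      : NNF k
  atom natom : Fin k → NNF k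
  _∧ᶠ_ _∨ᶠ_  : NNF k → NNF k → NNF k
  _U⟨_⟩_     : NNF k → Interval → NNF k → NNF k
  _Ũ⟨_⟩_     : NNF k → Interval → NNF k → NNF k

data _⊑_ {k : ℕ} : NNF k → NNF k → Set where
  here : ∀ {ψ} → ψ ⊑ ψ
  ∧ˡ : ∀ {ψ a b} → ψ ⊑ a → ψ ⊑ (a ∧ᶠ b)
  ∧ʳ : ∀ {ψ a b} → ψ ⊑ b → ψ ⊑ (a ∧ᶠ b)
  ∨ˡ : ∀ {ψ a b} → ψ ⊑ a → ψ ⊑ (a ∨ᶠ b)
  ∨ʳ : ∀ {ψ a b} → ψ ⊑ b → ψ ⊑ (a ∨ᶠ b)
  Uˡ : ∀ {ψ a I b} → ψ ⊑ a → ψ ⊑ (a U⟨ I ⟩ b)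
  Uʳ : ∀ {ψ a I b} → ψ ⊑ b → ψ ⊑ (a U⟨ I ⟩ b)
  Ũˡ : ∀ {ψ a I b} → ψ ⊑ a → ψ ⊑ (a Ũ⟨ I ⟩ b)
  Ũʳ : ∀ {ψ a I b} → ψ ⊑ b → ψ ⊑ (a Ũ⟨ I ⟩ b)

data Temporal {k : ℕ} : NNF k → Set where
  isU : ∀ {a I b} → Temporal (a U⟨ I ⟩ b)
  isŨ : ∀ {a I b} → Temporal (a Ũ⟨ I ⟩ b)

-- Γ(L): positive Boolean combinations of locations, clock constraints
-- and resets x.γ (free syntax; the identifications of the paper do not
-- change which locations are present).

data Cmp : Set where
  lt le gt ge : Cmp

data Γ (L : Set) : Set where
  ⊤ᵍ ⊥ᵍ     : Γ L
  _∨ᵍ_ _∧ᵍ_ : Γ L → Γ L → Γ L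
  loc       : L → Γ L
  clk       : Cmp → ℕ → Γ L
  reset     : Γ L → Γ L

data Present {L : Set} (ℓ : L) : Γ L → Set where
  p-loc : Present ℓ (loc ℓ)
  p-∨ˡ  : ∀ {γ₁ γ₂} → Present ℓ γ₁ → Present ℓ (γ₁ ∨ᵍ γ₂)
  p-∨ʳ  : ∀ {γ₁ γ₂} → Present ℓ γ₂ → Present ℓ (γ₁ ∨ᵍ γ₂)
  p-∧ˡ  : ∀ {γ₁ γ₂} → Present ℓ γ₁ → Present ℓ (γ₁ ∧ᵍ γ₂)
  p-∧ʳ  : ∀ {γ₁ γ₂} → Present ℓ γ₂ → Present ℓ (γ₁ ∧ᵍ γ₂)
  p-x   : ∀ {γ} → Present ℓ γ → Present ℓ (reset γ)

-- OCATA.  Locations are the elements of the ambient type Loc satisfying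
-- InL (the finite set L ⊆ Loc); δ is given on Loc.

record OCATA (Sig : Set) : Set₁ where
  field
    Loc : Set
    InL : Loc → Set
    ℓ₀  : Loc
    F   : Loc → Set
    δ   : Loc → Sig → Γ Loc

-- Tree-like OCATA: a partition L₁,…,Lₘ of L (given by a block map
-- cls, surjective from L onto Fin m, all blocks nonempty), each block
-- inside F or disjoint from F, and a partial order ≼ on blocks such that
-- ℓ' present in δ(ℓ,σ) with ℓ ∈ L_i, ℓ' ∈ L_j implies L_j ≼ L_i.

record TreeLikeWitness {Sig : Set} (A : OCATA Sig) : Set₁ where
  open OCATA A
  field
    m      : ℕ
    cls    : Loc → Fin m
    onto   : ∀ (i : Fin m) → ∃ λ ℓ → InL ℓ × cls ℓ ≡ i
    _≼_    : Fin m → Fin m → Set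
    po     : IsPartialOrder _≡_ _≼_
    accept : ∀ (i : Fin m) →
               (∀ ℓ → InL ℓ → cls ℓ ≡ i → F ℓ)
             ⊎ (∀ ℓ → InL ℓ → cls ℓ ≡ i → ¬ F ℓ)
    order  : ∀ (σ : Sig) (ℓ ℓ' : Loc) → InL ℓ → InL ℓ' →
               Present ℓ' (δ ℓ σ) → cls ℓ' ≼ cls ℓ

TOCATA : {Sig : Set} → OCATA Sig → Set₁
TOCATA A = TreeLikeWitness A

-- The construction A_φ.  Locations: Maybe (NNF k), with nothing = φ_init
-- and just ψ = the subformula ψ.

module Construction {k : ℕ} where

  Loc : Set
  Loc = Maybe (NNF k)

  x∈ : Interval → Γ Loc
  x∈ (interval a ca b cb) = lower ca ∧ᵍ upper b cb
    where
      lower : Bool → Γ Loc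
      lower true  = clk ge a
      lower false = clk gt a
      upper : Maybe ℕ → Bool → Γ Loc
      upper nothing  _     = ⊤ᵍ
      upper (just c) true  = clk le c
      upper (just c) false = clk lt c

  x∉ : Interval → Γ Loc
  x∉ (interval a ca b cb) = lower ca ∨ᵍ upper b cb
    where
      lower : Bool → Γ Loc
      lower true  = clk lt a
      lower false = clk le a
      upper : Maybe ℕ → Bool → Γ Loc
      upper nothing  _     = ⊥ᵍ
      upper (just c) true  = clk gt c
      upper (just c) false = clk ge c

  x≤sup : Interval → Γ Loc
  x≤sup (interval _ _ nothing  _) = ⊤ᵍ
  x≤sup (interval _ _ (just c) _) = clk le c

  x>sup : Interval → Γ Loc
  x>sup (interval _ _ nothing  _) = ⊥ᵍ
  x>sup (interval _ _ (just c) _) = clk gt c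

  δf : NNF k → Fin k → Γ Loc
  δf tt σ = ⊤ᵍ
  δf ff σ = ⊥ᵍ
  δf (atom s) σ with s ≟ σ
  ... | yes _ = ⊤ᵍ
  ... | no  _ = ⊥ᵍ
  δf (natom s) σ with s ≟ σ
  ... | yes _ = ⊥ᵍ
  ... | no  _ = ⊤ᵍ
  δf (a ∧ᶠ b) σ = δf a σ ∧ᵍ δf b σ
  δf (a ∨ᶠ b) σ = δf a σ ∨ᵍ δf b σ
  δf (a U⟨ I ⟩ b) σ =
      (reset (δf b σ) ∧ᵍ x∈ I)
    ∨ᵍ ((reset (δf a σ) ∧ᵍ loc (just (a U⟨ I ⟩ b))) ∧ᵍ x≤sup I)
  δf (a Ũ⟨ I ⟩ b) σ =
      (reset (δf b σ) ∨ᵍ x∉ I)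
    ∧ᵍ ((reset (δf a σ) ∨ᵍ loc (just (a Ũ⟨ I ⟩ b))) ∨ᵍ x>sup I)

  InL : NNF k → Loc → Set
  InL φ nothing  = Data.Unit.⊤ where import Data.Unit
  InL φ (just ψ) = (ψ ⊑ φ) × Temporal ψ

  Acc : Loc → Set
  Acc nothing = Data.Empty.⊥ where import Data.Empty
  Acc (just (a Ũ⟨ I ⟩ b)) = Data.Unit.⊤ where import Data.Unit
  Acc (just _) = Data.Empty.⊥ where import Data.Empty

  δA : NNF k → Loc → Fin k → Γ Loc
  δA φ nothing  σ = reset (δf φ σ)
  δA φ (just ψ) σ = δf ψ σ

  A : NNF k → OCATA (Fin k)
  A φ = record
    { Loc = Loc
    ; InL = InL φ
    ; ℓ₀  = nothing
    ; F   = Acc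
    ; δ   = δA φ
    }

A[_] : {k : ℕ} → NNF k → OCATA (Fin k)
A[ φ ] = Construction.A φ

module Submission where

-- Rank every location by formula size: the subformula ψ gets
-- rank |ψ| and the initial copy φ_init gets |φ| + 1.  Unfolding δ(ψ,σ)
-- only mentions ψ itself (the self-loop of U / Ũ) and locations coming
-- from strictly smaller subformulas, so every transition either stays
-- put or strictly decreases the rank.  We group locations into blocks by
-- the pair (rank, accepting?); blocks are then homogeneous w.r.t. F, and
-- the order "same block, or strictly smaller rank" is a partial order on
-- blocks that every transition respects.

open import Defs
open import Data.Nat using (ℕ; suc; _+_; _<_; s≤s)
open import Data.Nat.Properties using (<-trans; <-irrefl; m≤m+n; m≤n+m; n<1+n)
import Data.Nat.Properties as ℕ
open import Data.Bool using (Bool; true; false)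
import Data.Bool.Properties as Bool
open import Data.Fin using (Fin; zero; suc)
open import Data.Maybe using (just; nothing)
open import Data.Product using (Σ; ∃; _×_; _,_; proj₁; proj₂)
open import Data.Product.Properties using (≡-dec)
open import Data.Sum using (_⊎_; inj₁; inj₂)
open import Data.Empty using (⊥-elim)
open import Data.Unit using (tt)
open import Data.List using (List; []; _∷_; _++_; map; lookup; length; deduplicate)
open import Data.List.Membership.Propositional using (_∈_)
open import Data.List.Membership.Propositional.Properties
  using (∈-map⁺; ∈-map⁻; ∈-++⁺ˡ; ∈-++⁺ʳ; ∈-++⁻; ∈-lookup; ∈-deduplicate⁺; ∈-deduplicate⁻)
open import Data.List.Relation.Unary.Any using (here; there; index)
open import Data.List.Relation.Unary.Any.Properties using (lookup-index)
import Data.List.Relation.Unary.All as All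
open import Data.List.Relation.Unary.AllPairs using (_∷_)
open import Data.List.Relation.Unary.Unique.Propositional using (Unique)
open import Data.List.Relation.Unary.Unique.DecPropositional.Properties using (deduplicate-!)
open import Relation.Nullary using (¬_; yes; no; Dec; does)
open import Relation.Binary.PropositionalEquality
  using (_≡_; refl; sym; trans; cong; subst₂; isEquivalence; resp₂)
open import Relation.Binary.Structures using (IsStrictPartialOrder)
open import Relation.Binary.Definitions using (DecidableEquality)
open import Relation.Binary.Construct.Closure.Reflexive using (ReflClosure; refl; [_])
open import Relation.Binary.Construct.Closure.Reflexive.Properties using (isPartialOrder)

lookup-injective : ∀ {A : Set} (xs : List A) → Unique xs →
                   ∀ i j → lookup xs i ≡ lookup xs j → i ≡ j
lookup-injective (x ∷ xs) (x∉ ∷ u) zero    zero    _  = refl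
lookup-injective (x ∷ xs) (x∉ ∷ u) zero    (suc j) eq = ⊥-elim (All.lookup x∉ (∈-lookup j) eq)
lookup-injective (x ∷ xs) (x∉ ∷ u) (suc i) zero    eq = ⊥-elim (All.lookup x∉ (∈-lookup i) (sym eq))
lookup-injective (x ∷ xs) (x∉ ∷ u) (suc i) (suc j) eq = cong suc (lookup-injective xs u i j eq)

module FiniteQuotient {A K : Set} (_≟_ : DecidableEquality K) (key : A → K)
                      (elems : List A) {a₀ : A} (a₀∈ : a₀ ∈ elems) where
  open import Data.List.Membership.DecPropositional _≟_ using (_∈?_)

  labels : List K
  labels = deduplicate _≟_ (map key elems)

  m : ℕ
  m = length labels

  label : Fin m → K
  label = lookup labels

  key∈labels : ∀ {a} → a ∈ elems → key a ∈ labels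
  key∈labels a∈ = ∈-deduplicate⁺ _≟_ (∈-map⁺ key a∈)

  -- elements outside the list are sent to the block of a₀
  block : A → Fin m
  block a with key a ∈? labels
  ... | yes k∈ = index k∈
  ... | no  _  = index (key∈labels a₀∈)

  label-block : ∀ {a} → a ∈ elems → label (block a) ≡ key a
  label-block {a} a∈ with key a ∈? labels
  ... | yes k∈ = sym (lookup-index k∈)
  ... | no  k∉ = ⊥-elim (k∉ (key∈labels a∈))

  block-onto : ∀ i → ∃ λ a → a ∈ elems × block a ≡ i
  block-onto i with ∈-map⁻ key (∈-deduplicate⁻ _≟_ (map key elems) (∈-lookup i))
  ... | a , a∈ , i≡a = a , a∈ ,
        lookup-injective labels (deduplicate-! _≟_ _) (block a) i
          (trans (label-block a∈) (sym i≡a))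

does-true : ∀ {P : Set} (d : Dec P) → does d ≡ true → P
does-true (yes p) _ = p

does-false : ∀ {P : Set} (d : Dec P) → does d ≡ false → ¬ P
does-false (no ¬p) _ = ¬p

rank-isStrictPartialOrder : ∀ {A : Set} (r : A → ℕ) →
                            IsStrictPartialOrder _≡_ (λ x y → r x < r y)
rank-isStrictPartialOrder r = record
  { isEquivalence = isEquivalence
  ; irrefl        = λ { refl → <-irrefl refl }
  ; trans         = <-trans
  ; <-resp-≈      = resp₂ _
  }

module _ {k : ℕ} where

  temporalSubformulas : NNF k → List (NNF k)
  temporalSubformulas tt           = []
  temporalSubformulas ff           = []
  temporalSubformulas (atom _)     = []
  temporalSubformulas (natom _)    = []
  temporalSubformulas (a ∧ᶠ b)     = temporalSubformulas a ++ temporalSubformulas b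
  temporalSubformulas (a ∨ᶠ b)     = temporalSubformulas a ++ temporalSubformulas b
  temporalSubformulas (a U⟨ I ⟩ b) = (a U⟨ I ⟩ b) ∷ temporalSubformulas a ++ temporalSubformulas b
  temporalSubformulas (a Ũ⟨ I ⟩ b) = (a Ũ⟨ I ⟩ b) ∷ temporalSubformulas a ++ temporalSubformulas b

  ∈-temporalSubformulas⁺ : ∀ {ψ χ : NNF k} → ψ ⊑ χ → Temporal ψ → ψ ∈ temporalSubformulas χ
  ∈-temporalSubformulas⁺ here isU = here refl
  ∈-temporalSubformulas⁺ here isŨ = here refl
  ∈-temporalSubformulas⁺ (∧ˡ s) t = ∈-++⁺ˡ (∈-temporalSubformulas⁺ s t)
  ∈-temporalSubformulas⁺ (∧ʳ {a = a} s) t = ∈-++⁺ʳ (temporalSubformulas a) (∈-temporalSubformulas⁺ s t)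
  ∈-temporalSubformulas⁺ (∨ˡ s) t = ∈-++⁺ˡ (∈-temporalSubformulas⁺ s t)
  ∈-temporalSubformulas⁺ (∨ʳ {a = a} s) t = ∈-++⁺ʳ (temporalSubformulas a) (∈-temporalSubformulas⁺ s t)
  ∈-temporalSubformulas⁺ (Uˡ s) t = there (∈-++⁺ˡ (∈-temporalSubformulas⁺ s t))
  ∈-temporalSubformulas⁺ (Uʳ {a = a} s) t = there (∈-++⁺ʳ (temporalSubformulas a) (∈-temporalSubformulas⁺ s t))
  ∈-temporalSubformulas⁺ (Ũˡ s) t = there (∈-++⁺ˡ (∈-temporalSubformulas⁺ s t))
  ∈-temporalSubformulas⁺ (Ũʳ {a = a} s) t = there (∈-++⁺ʳ (temporalSubformulas a) (∈-temporalSubformulas⁺ s t))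

  mutual
    ∈-temporalSubformulas⁻ : ∀ (χ : NNF k) {ψ} → ψ ∈ temporalSubformulas χ → ψ ⊑ χ × Temporal ψ
    ∈-temporalSubformulas⁻ (a ∧ᶠ b)     p           = ∈-children⁻ a b ∧ˡ ∧ʳ p
    ∈-temporalSubformulas⁻ (a ∨ᶠ b)     p           = ∈-children⁻ a b ∨ˡ ∨ʳ p
    ∈-temporalSubformulas⁻ (a U⟨ I ⟩ b) (here refl) = here , isU
    ∈-temporalSubformulas⁻ (a U⟨ I ⟩ b) (there p)   = ∈-children⁻ a b Uˡ Uʳ p
    ∈-temporalSubformulas⁻ (a Ũ⟨ I ⟩ b) (here refl) = here , isŨ
    ∈-temporalSubformulas⁻ (a Ũ⟨ I ⟩ b) (there p)   = ∈-children⁻ a b Ũˡ Ũʳ p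

    ∈-children⁻ : ∀ (a b : NNF k) {χ ψ} →
                  (∀ {ψ} → ψ ⊑ a → ψ ⊑ χ) → (∀ {ψ} → ψ ⊑ b → ψ ⊑ χ) →
                  ψ ∈ temporalSubformulas a ++ temporalSubformulas b → ψ ⊑ χ × Temporal ψ
    ∈-children⁻ a b left right p with ∈-++⁻ (temporalSubformulas a) p
    ... | inj₁ q = let (s , t) = ∈-temporalSubformulas⁻ a q in left s , t
    ... | inj₂ q = let (s , t) = ∈-temporalSubformulas⁻ b q in right s , t

  size : NNF k → ℕ
  size tt           = 1
  size ff           = 1
  size (atom _)     = 1
  size (natom _)    = 1
  size (a ∧ᶠ b)     = suc (size a + size b)
  size (a ∨ᶠ b)     = suc (size a + size b)
  size (a U⟨ _ ⟩ b) = suc (size a + size b)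
  size (a Ũ⟨ _ ⟩ b) = suc (size a + size b)

  size-left : ∀ (a b : NNF k) → size a < suc (size a + size b)
  size-left a b = s≤s (m≤m+n (size a) (size b))

  size-right : ∀ (a b : NNF k) → size b < suc (size a + size b)
  size-right a b = s≤s (m≤n+m (size b) (size a))

  open Construction {k}

  LocationFree : Γ Loc → Set
  LocationFree γ = ∀ {ℓ} → ¬ Present ℓ γ

  x∈-free : ∀ I → LocationFree (x∈ I)
  x∈-free (interval _ true  _        _)     (p-∧ˡ ())
  x∈-free (interval _ false _        _)     (p-∧ˡ ())
  x∈-free (interval _ _     nothing  _)     (p-∧ʳ ())
  x∈-free (interval _ _     (just _) true)  (p-∧ʳ ())
  x∈-free (interval _ _     (just _) false) (p-∧ʳ ())

  x∉-free : ∀ I → LocationFree (x∉ I)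
  x∉-free (interval _ true  _        _)     (p-∨ˡ ())
  x∉-free (interval _ false _        _)     (p-∨ˡ ())
  x∉-free (interval _ _     nothing  _)     (p-∨ʳ ())
  x∉-free (interval _ _     (just _) true)  (p-∨ʳ ())
  x∉-free (interval _ _     (just _) false) (p-∨ʳ ())

  x≤sup-free : ∀ I → LocationFree (x≤sup I)
  x≤sup-free (interval _ _ nothing  _) ()
  x≤sup-free (interval _ _ (just _) _) ()

  x>sup-free : ∀ I → LocationFree (x>sup I)
  x>sup-free (interval _ _ nothing  _) ()
  x>sup-free (interval _ _ (just _) _) ()

  SmallerThan : ℕ → Loc → Set
  SmallerThan n ℓ = Σ (NNF k) λ χ → ℓ ≡ just χ × size χ < n

  ReachedFrom : NNF k → Loc → Set
  ReachedFrom ψ ℓ = ℓ ≡ just ψ ⊎ SmallerThan (size ψ) ℓ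

  reached-smaller : ∀ {a ℓ n} → ReachedFrom a ℓ → size a < n → SmallerThan n ℓ
  reached-smaller {a} (inj₁ ℓ≡a)             a<n = a , ℓ≡a , a<n
  reached-smaller     (inj₂ (χ , ℓ≡χ , χ<a)) a<n = χ , ℓ≡χ , <-trans χ<a a<n

  δf-reaches : ∀ ψ σ ℓ → Present ℓ (δf ψ σ) → ReachedFrom ψ ℓ
  δf-reaches (atom s) σ ℓ p with s Data.Fin.≟ σ
  δf-reaches (atom s) σ ℓ () | yes _
  δf-reaches (atom s) σ ℓ () | no _
  δf-reaches (natom s) σ ℓ p with s Data.Fin.≟ σ
  δf-reaches (natom s) σ ℓ () | yes _
  δf-reaches (natom s) σ ℓ () | no _
  δf-reaches (a ∧ᶠ b) σ ℓ (p-∧ˡ p) = inj₂ (reached-smaller (δf-reaches a σ ℓ p) (size-left a b))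
  δf-reaches (a ∧ᶠ b) σ ℓ (p-∧ʳ p) = inj₂ (reached-smaller (δf-reaches b σ ℓ p) (size-right a b))
  δf-reaches (a ∨ᶠ b) σ ℓ (p-∨ˡ p) = inj₂ (reached-smaller (δf-reaches a σ ℓ p) (size-left a b))
  δf-reaches (a ∨ᶠ b) σ ℓ (p-∨ʳ p) = inj₂ (reached-smaller (δf-reaches b σ ℓ p) (size-right a b))
  δf-reaches (a U⟨ I ⟩ b) σ ℓ (p-∨ˡ (p-∧ˡ (p-x p))) =
    inj₂ (reached-smaller (δf-reaches b σ ℓ p) (size-right a b))
  δf-reaches (a U⟨ I ⟩ b) σ ℓ (p-∨ˡ (p-∧ʳ p)) = ⊥-elim (x∈-free I p)
  δf-reaches (a U⟨ I ⟩ b) σ ℓ (p-∨ʳ (p-∧ˡ (p-∧ˡ (p-x p)))) =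
    inj₂ (reached-smaller (δf-reaches a σ ℓ p) (size-left a b))
  δf-reaches (a U⟨ I ⟩ b) σ ℓ (p-∨ʳ (p-∧ˡ (p-∧ʳ p-loc))) = inj₁ refl
  δf-reaches (a U⟨ I ⟩ b) σ ℓ (p-∨ʳ (p-∧ʳ p)) = ⊥-elim (x≤sup-free I p)
  δf-reaches (a Ũ⟨ I ⟩ b) σ ℓ (p-∧ˡ (p-∨ˡ (p-x p))) =
    inj₂ (reached-smaller (δf-reaches b σ ℓ p) (size-right a b))
  δf-reaches (a Ũ⟨ I ⟩ b) σ ℓ (p-∧ˡ (p-∨ʳ p)) = ⊥-elim (x∉-free I p)
  δf-reaches (a Ũ⟨ I ⟩ b) σ ℓ (p-∧ʳ (p-∨ˡ (p-∨ˡ (p-x p)))) =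
    inj₂ (reached-smaller (δf-reaches a σ ℓ p) (size-left a b))
  δf-reaches (a Ũ⟨ I ⟩ b) σ ℓ (p-∧ʳ (p-∨ˡ (p-∨ʳ p-loc))) = inj₁ refl
  δf-reaches (a Ũ⟨ I ⟩ b) σ ℓ (p-∧ʳ (p-∨ʳ p)) = ⊥-elim (x>sup-free I p)

  accepting? : ∀ ℓ → Dec (Acc ℓ)
  accepting? nothing                   = no λ ()
  accepting? (just tt)                 = no λ ()
  accepting? (just ff)                 = no λ ()
  accepting? (just (atom _))           = no λ ()
  accepting? (just (natom _))          = no λ ()
  accepting? (just (_ ∧ᶠ _))           = no λ ()
  accepting? (just (_ ∨ᶠ _))           = no λ ()
  accepting? (just (_ U⟨ _ ⟩ _))       = no λ ()
  accepting? (just (_ Ũ⟨ _ ⟩ _))       = yes tt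

  module Automaton (φ : NNF k) where

    locations : List Loc
    locations = nothing ∷ map just (temporalSubformulas φ)

    ∈-locations⁺ : ∀ {ℓ} → InL φ ℓ → ℓ ∈ locations
    ∈-locations⁺ {nothing} _       = here refl
    ∈-locations⁺ {just ψ}  (s , t) = there (∈-map⁺ just (∈-temporalSubformulas⁺ s t))

    ∈-locations⁻ : ∀ {ℓ} → ℓ ∈ locations → InL φ ℓ
    ∈-locations⁻ (here refl) = tt
    ∈-locations⁻ (there p) with ∈-map⁻ just p
    ... | ψ , q , refl = ∈-temporalSubformulas⁻ φ q

    -- φ_init sits above every subformula
    rank : Loc → ℕ
    rank nothing  = suc (size φ)
    rank (just ψ) = size ψ

    smaller-rank : ∀ {n ℓ} → SmallerThan n ℓ → rank ℓ < n
    smaller-rank (_ , refl , χ<n) = χ<n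

    δA-descends : ∀ σ ℓ ℓ' → Present ℓ' (δA φ ℓ σ) → ℓ' ≡ ℓ ⊎ rank ℓ' < rank ℓ
    δA-descends σ nothing ℓ' (p-x p) =
      inj₂ (smaller-rank (reached-smaller (δf-reaches φ σ ℓ' p) (n<1+n (size φ))))
    δA-descends σ (just ψ) ℓ' p with δf-reaches ψ σ ℓ' p
    ... | inj₁ ℓ'≡ψ   = inj₁ ℓ'≡ψ
    ... | inj₂ smaller = inj₂ (smaller-rank smaller)

    blockKey : Loc → ℕ × Bool
    blockKey ℓ = rank ℓ , does (accepting? ℓ)

    open FiniteQuotient (≡-dec ℕ._≟_ Bool._≟_) blockKey locations (here refl) public

    blockRank : Fin m → ℕ
    blockRank i = proj₁ (label i)

    _≼_ : Fin m → Fin m → Set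
    _≼_ = ReflClosure (λ i j → blockRank i < blockRank j)

    key-of-member : ∀ {ℓ i} → InL φ ℓ → block ℓ ≡ i → blockKey ℓ ≡ label i
    key-of-member inL refl = sym (label-block (∈-locations⁺ inL))

    homogeneous : ∀ i → (∀ ℓ → InL φ ℓ → block ℓ ≡ i → Acc ℓ)
                      ⊎ (∀ ℓ → InL φ ℓ → block ℓ ≡ i → ¬ Acc ℓ)
    homogeneous i with proj₂ (label i) in acc≡
    ... | true  = inj₁ λ ℓ inL ℓ∈i →
                    does-true (accepting? ℓ) (trans (cong proj₂ (key-of-member inL ℓ∈i)) acc≡)
    ... | false = inj₂ λ ℓ inL ℓ∈i →
                    does-false (accepting? ℓ) (trans (cong proj₂ (key-of-member inL ℓ∈i)) acc≡)

    respects-δ : ∀ σ ℓ ℓ' → InL φ ℓ → InL φ ℓ' → Present ℓ' (δA φ ℓ σ) → block ℓ' ≼ block ℓ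
    respects-δ σ ℓ ℓ' inL inL' p with δA-descends σ ℓ ℓ' p
    ... | inj₁ refl     = refl
    ... | inj₂ rank-lt = [ subst₂ _<_ (rank-of inL') (rank-of inL) rank-lt ]
      where
        rank-of : ∀ {ℓ} → InL φ ℓ → rank ℓ ≡ blockRank (block ℓ)
        rank-of inL = cong proj₁ (key-of-member inL refl)

proposition2 : (k : ℕ) (φ : NNF k) → TOCATA A[ φ ]
proposition2 k φ = record
  { m      = m
  ; cls    = block
  ; onto   = λ i → let (ℓ , ℓ∈ , ℓ∈i) = block-onto i in ℓ , ∈-locations⁻ ℓ∈ , ℓ∈i
  ; _≼_    = _≼_
  ; po     = isPartialOrder (rank-isStrictPartialOrder blockRank)
  ; accept = homogeneous
  ; order  = respects-δ
  }
  where open Automaton φ
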